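{- Let $A$ be a meet-complemented lattice in which $\Box a$ exists for every $a\in A$. If $Da$ exists for every $a\in A$, then $Da\le\neg\Box a$ for every $a\in A$.
   Context: A meet-complemented lattice is a lattice $(A,\wedge,\vee)$, not necessarily distributive, such that for every $a\in A$ the element $\neg a=\max\{b\in A: a\wedge b\le c\text{ for all }c\in A\}$ exists; it is bounded, with least element $0$ and greatest element $1$. For $a\in A$, $\Box a$ denotes $\max\{b\in A: a\vee\neg b=1\}$ and $Da$ denotes the least $b\in A$ with $a\vee b=1$, when these exist. -}

module Defs where

open import Level using (Level; _⊔_)
open import Data.Product using (_×_)
open import Relation.Binary.Lattice.Bundles using (BoundedLattice)

module _ {c ℓ₁ ℓ₂ : Level} (L : BoundedLattice c ℓ₁ ℓ₂) where
  open BoundedLattice L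

  IsMax : (Carrier → Set (c ⊔ ℓ₁ ⊔ ℓ₂)) → Carrier → Set (c ⊔ ℓ₁ ⊔ ℓ₂)
  IsMax P m = P m × (∀ b → P b → b ≤ m)

  IsMin : (Carrier → Set (c ⊔ ℓ₁ ⊔ ℓ₂)) → Carrier → Set (c ⊔ ℓ₁ ⊔ ℓ₂)
  IsMin P m = P m × (∀ b → P b → m ≤ b)

  IsMeetComplement : (Carrier → Carrier) → Set (c ⊔ ℓ₁ ⊔ ℓ₂)
  IsMeetComplement n = ∀ a → IsMax (λ b → Level.Lift (c ⊔ ℓ₁ ⊔ ℓ₂) (∀ x → (a ∧ b) ≤ x)) (n a)

  IsBox : (Carrier → Carrier) → (Carrier → Carrier) → Set (c ⊔ ℓ₁ ⊔ ℓ₂)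
  IsBox n box = ∀ a → IsMax (λ b → Level.Lift (c ⊔ ℓ₁ ⊔ ℓ₂) ((a ∨ n b) ≈ ⊤)) (box a)

  IsD : (Carrier → Carrier) → Set (c ⊔ ℓ₁ ⊔ ℓ₂)
  IsD d = ∀ a → IsMin (λ b → Level.Lift (c ⊔ ℓ₁ ⊔ ℓ₂) ((a ∨ b) ≈ ⊤)) (d a)

module Submission where

-- By definition, □a is the largest b with a ∨ ¬b = 1;
-- in particular □a itself satisfies a ∨ ¬□a = 1, i.e. ¬□a is a complement-
-- from-above ("join supplement") of a.  Da is the least element whose join
-- with a is 1, so Da lies below every such supplement, and hence Da ≤ ¬□a.
--
-- Notably the
-- argument does not use that `neg` is the meet complement, so the theorem
-- holds for any operation `neg` with respect to which □ is defined.

open import Defs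
open import Relation.Binary.Lattice.Bundles using (BoundedLattice)
open import Data.Product using (proj₁; proj₂)
open import Level using (lift; lower)

module _ {c ℓ₁ ℓ₂} (L : BoundedLattice c ℓ₁ ℓ₂) where
  open BoundedLattice L

  box-supplement : (neg box : Carrier → Carrier) → IsBox L neg box →
                   ∀ a → (a ∨ neg (box a)) ≈ ⊤
  box-supplement neg box isBox a = lower (proj₁ (isBox a))

  D-least : (D : Carrier → Carrier) → IsD L D →
            ∀ a b → (a ∨ b) ≈ ⊤ → D a ≤ b
  D-least D isD a b a∨b≈⊤ = proj₂ (isD a) b (lift a∨b≈⊤)

proposition4 : ∀ {c ℓ₁ ℓ₂} (L : BoundedLattice c ℓ₁ ℓ₂) (neg box D : BoundedLattice.Carrier L → BoundedLattice.Carrier L) →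
    IsMeetComplement L neg → IsBox L neg box → IsD L D →
    ∀ a → BoundedLattice._≤_ L (D a) (neg (box a))
proposition4 L neg box D _ isBox isD a =
  D-least L D isD a (neg (box a)) (box-supplement L neg box isBox a)
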